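{- Let $G$ be a group and $H\leq A \leq G$. If $A$ is a perfect code of $(G,H)$, then for any $g\in G$ either the left coset $gA$ contains an element $x$ such that $x^2\in b^{ -1}Hb$ for some $b\in A$ or $A\{g,g^{ -1}\}A$ is a disjoint union $g_{1}A\cup\cdots\cup g_{m}A$ of left cosets for some $g_{1},\ldots,g_{m}\in G$ where $m$ is an even integer.
   Context: All groups are finite. For a group $G$, a subgroup $H\leq G$ and a subset $U\subseteq G$ which is a union of double cosets of $H$ with $H\cap U=\emptyset$ and $U^{ -1}=U$, the coset graph $\mathrm{Cos}(G,H,U)$ has as vertex set the set of left cosets of $H$ in $G$, with $g_1H$ and $g_2H$ adjacent iff $g_1^{ -1}g_2\in U$. A perfect code in a graph is an independent set $C$ of vertices such that every vertex outside $C$ is adjacent to exactly one vertex of $C$. For $H\leq A\leq G$, $A$ is called a perfect code of the pair $(G,H)$ if there is a coset graph $\mathrm{Cos}(G,H,U)$ in which the set $\{aH: a\in A\}$ of left cosets of $H$ contained in $A$ is a perfect code. -}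

module Defs where

open import Level using (Level; _⊔_)
open import Algebra.Bundles using (Group)
open import Data.Bool using (Bool; T)
open import Data.List using (List; length)
open import Data.List.Relation.Unary.Any using (Any)
open import Data.List.Relation.Unary.AllPairs using (AllPairs)
open import Data.Nat using (ℕ)
open import Data.Nat.Divisibility using (_∣_)
open import Data.Product using (Σ; _×_; ∃)
open import Data.Sum using (_⊎_)
open import Relation.Nullary using (¬_)
open import Relation.Binary.Definitions using (Decidable)
open import Relation.Binary.PropositionalEquality using (_≡_)
open import Function.Bundles using (_⇔_)

record FiniteGroup (c ℓ : Level) : Set (Level.suc (c ⊔ ℓ)) where
  field
    group    : Group c ℓ
  open Group group public
  field
    _≟_      : Decidable _≈_
    elements : List Carrier
    complete : ∀ x → Any (x ≈_) elements

module _ {c ℓ : Level} (G : FiniteGroup c ℓ) where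
  open FiniteGroup G

  record Subset : Set (c ⊔ ℓ) where
    field
      χ        : Carrier → Bool
      respects : ∀ {x y} → x ≈ y → χ x ≡ χ y

  _∈ₛ_ : Carrier → Subset → Set
  x ∈ₛ S = T (Subset.χ S x)

  record Subgroup : Set (c ⊔ ℓ) where
    field
      set    : Subset
    field
      ε-mem  : ε ∈ₛ set
      ∙-mem  : ∀ {x y} → x ∈ₛ set → y ∈ₛ set → (x ∙ y) ∈ₛ set
      ⁻¹-mem : ∀ {x} → x ∈ₛ set → (x ⁻¹) ∈ₛ set

  _≤G_ : Subgroup → Subgroup → Set c
  H ≤G A = ∀ x → x ∈ₛ Subgroup.set H → x ∈ₛ Subgroup.set A

  -- Admissible connection sets U for the coset graph Cos(G,H,U):
  -- U is a union of double cosets HuH, H ∩ U = ∅ and U⁻¹ = U.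
  record ConnectionSet (H : Subgroup) (U : Subset) : Set c where
    field
      doubleCosets : ∀ h₁ u h₂ → h₁ ∈ₛ Subgroup.set H → u ∈ₛ U →
                     h₂ ∈ₛ Subgroup.set H → ((h₁ ∙ u) ∙ h₂) ∈ₛ U
      disjoint     : ∀ x → x ∈ₛ Subgroup.set H → ¬ (x ∈ₛ U)
      symmetric    : ∀ x → x ∈ₛ U → (x ⁻¹) ∈ₛ U

  -- Vertices of Cos(G,H,U) are the left cosets xH, represented by x.
  -- Two representatives give the same vertex iff x⁻¹y ∈ H.
  sameCoset : Subgroup → Carrier → Carrier → Set
  sameCoset H x y = ((x ⁻¹) ∙ y) ∈ₛ Subgroup.set H

  adjacent : Subset → Carrier → Carrier → Set
  adjacent U x y = ((x ⁻¹) ∙ y) ∈ₛ U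

  inCode : Subgroup → Subgroup → Carrier → Set c
  inCode H A x = ∃ λ a → a ∈ₛ Subgroup.set A × sameCoset H x a

  IsPerfectCodeIn : Subgroup → Subgroup → Subset → Set c
  IsPerfectCodeIn H A U =
    (∀ x y → inCode H A x → inCode H A y → ¬ adjacent U x y) ×
    (∀ x → ¬ inCode H A x →
       ∃ λ y → inCode H A y × adjacent U x y ×
         (∀ z → inCode H A z → adjacent U x z → sameCoset H y z))

  PerfectCodeOfPair : Subgroup → Subgroup → Set (c ⊔ ℓ)
  PerfectCodeOfPair H A =
    ∃ λ (U : Subset) → ConnectionSet H U × IsPerfectCodeIn H A U

  inLeftCoset : Subgroup → Carrier → Carrier → Set (c ⊔ ℓ)
  inLeftCoset A x y = ∃ λ a → a ∈ₛ Subgroup.set A × y ≈ x ∙ a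

  inDoubleSet : Subgroup → Carrier → Carrier → Set (c ⊔ ℓ)
  inDoubleSet A g y = ∃ λ a₁ → ∃ λ a₂ →
    a₁ ∈ₛ Subgroup.set A × a₂ ∈ₛ Subgroup.set A ×
    (y ≈ (a₁ ∙ g) ∙ a₂ ⊎ y ≈ (a₁ ∙ (g ⁻¹)) ∙ a₂)

  SquareAlternative : Subgroup → Subgroup → Carrier → Set (c ⊔ ℓ)
  SquareAlternative H A g =
    ∃ λ x → inLeftCoset A g x ×
      ∃ λ b → b ∈ₛ Subgroup.set A ×
        ∃ λ h → h ∈ₛ Subgroup.set H × (x ∙ x) ≈ ((b ⁻¹) ∙ h) ∙ b

  EvenCosetAlternative : Subgroup → Carrier → Set (c ⊔ ℓ)
  EvenCosetAlternative A g =
    ∃ λ (gs : List Carrier) →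
      AllPairs (λ gᵢ gⱼ → ∀ y → ¬ (inLeftCoset A gᵢ y × inLeftCoset A gⱼ y)) gs ×
      (∀ y → inDoubleSet A g y ⇔ Any (λ gᵢ → inLeftCoset A gᵢ y) gs) ×
      2 ∣ length gs

-- Let U be a connection set in which the cosets of H inside A form a perfect code. Then U ∩ A = ∅,
-- and if u, v ∈ U with u⁻¹v ∈ A then already u⁻¹v ∈ H, since u⁻¹H has only one neighbour in the code.
-- For g ∈ A take x = 1. For g ∉ A put W = U ∩ A{g,g⁻¹}A. Each y ∈ A{g,g⁻¹}A lies outside A, so
-- yz ∈ U for some z ∈ A, and y ∈ wA for some w ∈ W; two elements of W lie in the same left coset of A
-- iff they lie in the same left coset of H. Hence A{g,g⁻¹}A is the disjoint union of the cosets wA,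
-- w running over representatives of the left H-cosets in W, and m = |W| / |H|.
-- W is closed under inversion and is a union of double cosets HwH. If no w ∈ W has w⁻¹ ∈ HwH,
-- inversion pairs each HwH with a different double coset Hw⁻¹H of the same size, a multiple of |H|,
-- so m is even. If w⁻¹ = h₁wh₂, then y = wh₁ ∈ A{g,g⁻¹}A has y² = h₂⁻¹h₁ ∈ H, and conjugating
-- y or y⁻¹ by an element b of A gives x ∈ gA with x² ∈ b⁻¹Hb.
module Submission where

open import Level using (Level; _⊔_)
import Algebra.Properties.Group as GroupProperties
import Data.Nat.Properties as ℕ
open import Algebra.Properties.CommutativeSemigroup ℕ.+-commutativeSemigroup
  using (interchange; x∙yz≈y∙xz)
open import Data.Bool using (Bool; true; false; T; _∧_; _∨_; not)
open import Data.Bool.Properties using (T-∨)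
open import Data.Empty using (⊥-elim)
open import Data.List using (List; []; _∷_; length; map; deduplicate)
open import Data.Bool.ListAction using (any)
open import Data.List.Relation.Unary.All using (All; []; _∷_; lookupAny; lookupWith)
import Data.List.Relation.Unary.All as All
open import Data.List.Relation.Unary.All.Properties using (─⁺)
open import Data.List.Relation.Unary.AllPairs using (AllPairs; []; _∷_)
open import Data.List.Relation.Unary.Any using (Any; here; there)
import Data.List.Relation.Unary.Any as Any
open import Data.List.Relation.Unary.Any.Properties using (any⁺; any⁻)
open import Data.Nat using (ℕ; zero; suc; _+_; _*_; _≤_; z≤n; s≤s; >-nonZero)
open import Data.Nat.Divisibility using (_∣_; divides; _∣0; ∣m∣n⇒∣m+n; *-monoʳ-∣; *-cancelʳ-∣)
open import Data.Nat.Tactic.RingSolver using (solve-∀)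
open import Data.Product using (∃; _×_; _,_; proj₁; proj₂)
open import Data.Sum using (_⊎_; inj₁; inj₂)
import Data.Sum as Sum
open import Function using (_∘_)
open import Function.Bundles using (Equivalence; _⇔_; mk⇔)
open import Relation.Binary.Bundles using (DecSetoid)
open import Relation.Binary.Core using (_Preserves_⟶_)
import Relation.Binary.PropositionalEquality as ≡
open ≡ using (_≡_)
open import Relation.Nullary using (¬_; yes; no)
open import Relation.Nullary.Decidable using (T?)

open import Defs

T-extensional : ∀ {a b} → (T a → T b) → (T b → T a) → a ≡ b
T-extensional {false} {false} _ _ = ≡.refl
T-extensional {false} {true}  _ g = ⊥-elim (g _)
T-extensional {true}  {false} f _ = ⊥-elim (f _)
T-extensional {true}  {true}  _ _ = ≡.refl

≤-peel : ∀ {a b n} → 1 ≤ a → a + b ≤ suc n → b ≤ n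
≤-peel {suc a} _ (s≤s a+b≤n) = ℕ.m+n≤o⇒n≤o a a+b≤n

AllPairs-mapWith : ∀ {a p r s} {A : Set a} {P : A → Set p} {R : A → A → Set r} {S : A → A → Set s} →
                   (∀ {x y} → P x → P y → R x y → S x y) →
                   ∀ {xs} → All P xs → AllPairs R xs → AllPairs S xs
AllPairs-mapWith f []         []           = []
AllPairs-mapWith f (px ∷ pxs) (rxs ∷ rxss) = go pxs rxs ∷ AllPairs-mapWith f pxs rxss
  where
  go : ∀ {ys} → All _ ys → All _ ys → All _ ys
  go []         []         = []
  go (py ∷ pys) (rxy ∷ rxys) = f px py rxy ∷ go pys rxys

module Counting {a ℓ} (S : DecSetoid a ℓ) where
  open DecSetoid S
  open import Data.List.Membership.Setoid setoid using (_∈_; _─_)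
  open import Data.List.Membership.Setoid.Properties using (∈-resp-≈; ∈-map⁺)
  open import Data.List.Relation.Unary.Unique.Setoid setoid using (Unique)
  import Data.List.Relation.Unary.Unique.Setoid.Properties as Unique
  open import Data.List.Relation.Unary.Unique.DecSetoid.Properties using (deduplicate-!)
  open import Data.List.Relation.Unary.Enumerates.Setoid.Properties using (deduplicate⁺)

  infixl 7 _∩_ _∖_
  infix 4 _⊆_

  _∩_ _∖_ : (Carrier → Bool) → (Carrier → Bool) → Carrier → Bool
  (p ∩ q) x = p x ∧ q x
  (p ∖ q) x = p x ∧ not (q x)

  _⊆_ : (Carrier → Bool) → (Carrier → Bool) → Set a
  p ⊆ q = ∀ {x} → T (p x) → T (q x)

  ∩⁺ : ∀ p q {x} → T (p x) → T (q x) → T ((p ∩ q) x)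
  ∩⁺ p q {x} px qx with p x | q x
  ... | true | true = _

  ∩⁻ : ∀ p q {x} → T ((p ∩ q) x) → T (p x) × T (q x)
  ∩⁻ p q {x} pqx with p x | q x
  ... | true | true = _ , _

  ∖⁺ : ∀ p q {x} → T (p x) → ¬ T (q x) → T ((p ∖ q) x)
  ∖⁺ p q {x} px ¬qx with p x | q x
  ... | true | true  = ¬qx _
  ... | true | false = _

  ∖⁻ : ∀ p q {x} → T ((p ∖ q) x) → T (p x) × ¬ T (q x)
  ∖⁻ p q {x} px∖qx with p x | q x
  ... | true | false = _ , λ ()

  ∖-cong : ∀ {p q} → p Preserves _≈_ ⟶ _≡_ → q Preserves _≈_ ⟶ _≡_ →
           (p ∖ q) Preserves _≈_ ⟶ _≡_
  ∖-cong p-cong q-cong x≈y = ≡.cong₂ _∧_ (p-cong x≈y) (≡.cong not (q-cong x≈y))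

  toℕ : Bool → ℕ
  toℕ false = 0
  toℕ true  = 1

  count : (Carrier → Bool) → List Carrier → ℕ
  count p []       = 0
  count p (x ∷ xs) = toℕ (p x) + count p xs

  module _ {p : Carrier → Bool} where

    count-cong : ∀ {q} → (∀ x → p x ≡ q x) → ∀ xs → count p xs ≡ count q xs
    count-cong p≗q []       = ≡.refl
    count-cong p≗q (x ∷ xs) = ≡.cong₂ (λ b n → toℕ b + n) (p≗q x) (count-cong p≗q xs)

    count-map : ∀ f xs → count p (map f xs) ≡ count (p ∘ f) xs
    count-map f []       = ≡.refl
    count-map f (x ∷ xs) = ≡.cong (toℕ (p (f x)) +_) (count-map f xs)

    count-split : ∀ q xs → count p xs ≡ count (p ∩ q) xs + count (p ∖ q) xs
    count-split q []       = ≡.refl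
    count-split q (x ∷ xs) = ≡.trans
      (≡.cong₂ _+_ (toℕ-split (p x) (q x)) (count-split q xs))
      (interchange (toℕ (p x ∧ q x)) (toℕ (p x ∧ not (q x))) _ _)
      where
      toℕ-split : ∀ b c → toℕ b ≡ toℕ (b ∧ c) + toℕ (b ∧ not c)
      toℕ-split false _     = ≡.refl
      toℕ-split true  false = ≡.refl
      toℕ-split true  true  = ≡.refl

    count-empty : (∀ x → ¬ T (p x)) → ∀ xs → count p xs ≡ 0
    count-empty none []       = ≡.refl
    count-empty none (x ∷ xs) with p x in px
    ... | true  = ⊥-elim (none x (≡.subst T (≡.sym px) _))
    ... | false = count-empty none xs

    count-positive : p Preserves _≈_ ⟶ _≡_ → ∀ {x xs} → x ∈ xs → T (p x) → 1 ≤ count p xs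
    count-positive p-cong {x} (here {y} x≈y) px with p y in py
    ... | true  = s≤s z≤n
    ... | false = ⊥-elim (≡.subst T (≡.trans (p-cong x≈y) py) px)
    count-positive p-cong {xs = y ∷ _} (there x∈xs) px =
      ℕ.≤-trans (count-positive p-cong x∈xs px) (ℕ.m≤n+m _ (toℕ (p y)))

    count-─ : p Preserves _≈_ ⟶ _≡_ → ∀ {x} ys (x∈ys : x ∈ ys) →
              count p ys ≡ toℕ (p x) + count p (ys ─ x∈ys)
    count-─ p-cong (y ∷ ys) (here x≈y) = ≡.cong (λ b → toℕ b + count p ys) (p-cong (sym x≈y))
    count-─ p-cong {x} (y ∷ ys) (there x∈ys) = ≡.trans
      (≡.cong (toℕ (p y) +_) (count-─ p-cong ys x∈ys))
      (x∙yz≈y∙xz (toℕ (p y)) (toℕ (p x)) _)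

  ∈-─⁺ : ∀ {x z} ys (x∈ys : x ∈ ys) → z ∈ ys → ¬ z ≈ x → z ∈ (ys ─ x∈ys)
  ∈-─⁺ (y ∷ ys) (here x≈y)   (here z≈y)   z≉x = ⊥-elim (z≉x (trans z≈y (sym x≈y)))
  ∈-─⁺ (y ∷ ys) (here _)     (there z∈ys) _   = z∈ys
  ∈-─⁺ (y ∷ ys) (there _)    (here z≈y)   _   = here z≈y
  ∈-─⁺ (y ∷ ys) (there x∈ys) (there z∈ys) z≉x = there (∈-─⁺ ys x∈ys z∈ys z≉x)

  ∈-─⁻ : ∀ {x z} ys (x∈ys : x ∈ ys) → z ∈ (ys ─ x∈ys) → z ∈ ys
  ∈-─⁻ (y ∷ ys) (here _)     z∈ys         = there z∈ys
  ∈-─⁻ (y ∷ ys) (there _)    (here z≈y)   = here z≈y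
  ∈-─⁻ (y ∷ ys) (there x∈ys) (there z∈ys) = there (∈-─⁻ ys x∈ys z∈ys)

  ∉-─ : ∀ {x z} ys (x∈ys : x ∈ ys) → Unique ys → z ∈ (ys ─ x∈ys) → ¬ z ≈ x
  ∉-─ (y ∷ ys) (here x≈y) (y≉ys ∷ _) z∈ys z≈x =
    lookupWith (λ y≉w z≈w → y≉w (trans (sym x≈y) (trans (sym z≈x) z≈w))) y≉ys z∈ys
  ∉-─ (y ∷ ys) (there x∈ys) (y≉ys ∷ _) (here z≈y) z≈x =
    lookupWith (λ y≉w x≈w → y≉w (trans (sym z≈y) (trans z≈x x≈w))) y≉ys x∈ys
  ∉-─ (y ∷ ys) (there x∈ys) (_ ∷ ys!) (there z∈ys) z≈x = ∉-─ ys x∈ys ys! z∈ys z≈x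

  Unique-─ : ∀ {x} ys (x∈ys : x ∈ ys) → Unique ys → Unique (ys ─ x∈ys)
  Unique-─ (y ∷ ys) (here _)     (_ ∷ ys!)     = ys!
  Unique-─ (y ∷ ys) (there x∈ys) (y≉ys ∷ ys!) = ─⁺ x∈ys y≉ys ∷ Unique-─ ys x∈ys ys!

  count-unique-cong : ∀ {p} → p Preserves _≈_ ⟶ _≡_ → ∀ {xs ys} → Unique xs → Unique ys →
                      (∀ {z} → z ∈ xs → z ∈ ys) → (∀ {z} → z ∈ ys → z ∈ xs) →
                      count p xs ≡ count p ys
  count-unique-cong p-cong {[]} {[]} _ _ _ _ = ≡.refl
  count-unique-cong p-cong {[]} {y ∷ ys} _ _ _ ys⊆xs with ys⊆xs (here refl)
  ... | ()
  count-unique-cong {p} p-cong {x ∷ xs} {ys} (x≉xs ∷ xs!) ys! xs⊆ys ys⊆xs = ≡.trans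
    (≡.cong (toℕ (p x) +_) (count-unique-cong p-cong xs! (Unique-─ ys x∈ys ys!) xs⊆ys─x ys─x⊆xs))
    (≡.sym (count-─ p-cong ys x∈ys))
    where
    x∈ys = xs⊆ys (here refl)
    xs⊆ys─x : ∀ {z} → z ∈ xs → z ∈ (ys ─ x∈ys)
    xs⊆ys─x z∈xs = ∈-─⁺ ys x∈ys (xs⊆ys (there z∈xs))
      (λ z≈x → lookupWith (λ x≉w z≈w → x≉w (trans (sym z≈x) z≈w)) x≉xs z∈xs)
    ys─x⊆xs : ∀ {z} → z ∈ (ys ─ x∈ys) → z ∈ xs
    ys─x⊆xs z∈ys─x with ys⊆xs (∈-─⁻ ys x∈ys z∈ys─x)
    ... | here z≈x    = ⊥-elim (∉-─ ys x∈ys ys! z∈ys─x z≈x)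
    ... | there z∈xs = z∈xs

  module Size (elements : List Carrier) (complete : ∀ x → x ∈ elements) where

    enumeration : List Carrier
    enumeration = deduplicate _≟_ elements

    enumeration-complete : ∀ x → x ∈ enumeration
    enumeration-complete = deduplicate⁺ S complete

    enumeration-unique : Unique enumeration
    enumeration-unique = deduplicate-! S elements

    size : (Carrier → Bool) → ℕ
    size p = count p enumeration

    size-cong : ∀ {p q} → p ⊆ q → q ⊆ p → size p ≡ size q
    size-cong p⊆q q⊆p = count-cong (λ x → T-extensional p⊆q q⊆p) enumeration

    size-positive : ∀ {p} → p Preserves _≈_ ⟶ _≡_ → ∀ {x} → T (p x) → 1 ≤ size p
    size-positive p-cong {x} = count-positive p-cong (enumeration-complete x)

    size-empty : ∀ {p} → (∀ x → ¬ T (p x)) → size p ≡ 0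
    size-empty none = count-empty none enumeration

    empty⊎witness : ∀ p → p Preserves _≈_ ⟶ _≡_ → (∀ x → ¬ T (p x)) ⊎ ∃ (T ∘ p)
    empty⊎witness p p-cong with Any.any? (T? ∘ p) enumeration
    ... | yes witness = inj₂ (Any.satisfied witness)
    ... | no  none    = inj₁ λ x px →
      none (Any.map (λ x≈y → ≡.subst T (p-cong x≈y) px) (enumeration-complete x))

    size-⊆-split : ∀ {p q} → q ⊆ p → size p ≡ size q + size (p ∖ q)
    size-⊆-split {p} {q} q⊆p = ≡.trans (count-split q enumeration)
      (≡.cong (_+ size (p ∖ q)) (size-cong (λ {x} → proj₂ ∘ ∩⁻ p q) (λ qx → ∩⁺ p q (q⊆p qx) qx)))

    size-∘-bijection : ∀ {p} → p Preserves _≈_ ⟶ _≡_ → ∀ f f⁻¹ →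
                       f Preserves _≈_ ⟶ _≈_ → f⁻¹ Preserves _≈_ ⟶ _≈_ →
                       (∀ x → f (f⁻¹ x) ≈ x) → (∀ x → f⁻¹ (f x) ≈ x) →
                       size (p ∘ f) ≡ size p
    size-∘-bijection {p} p-cong f f⁻¹ f-cong f⁻¹-cong f∘f⁻¹ f⁻¹∘f = ≡.trans
      (≡.sym (count-map f enumeration))
      (count-unique-cong p-cong
        (Unique.map⁺ setoid setoid f-injective enumeration-unique) enumeration-unique
        (λ {z} _ → enumeration-complete z)
        (λ {z} _ → ∈-resp-≈ setoid (f∘f⁻¹ z) (∈-map⁺ setoid setoid f-cong (enumeration-complete (f⁻¹ z)))))
      where
      f-injective : ∀ {x y} → f x ≈ f y → x ≈ y
      f-injective {x} {y} fx≈fy = trans (sym (f⁻¹∘f x)) (trans (f⁻¹-cong fx≈fy) (f⁻¹∘f y))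

module FiniteGroupTheory {c ℓ} (G : FiniteGroup c ℓ) where
  open FiniteGroup G
  open GroupProperties group
    using (⁻¹-involutive; ⁻¹-anti-homo-∙; ε⁻¹≈ε; \\-leftDividesˡ; \\-leftDividesʳ; //-rightDividesʳ)
  open import Relation.Binary.Reasoning.Setoid setoid

  decSetoid : DecSetoid c ℓ
  decSetoid = record { isDecEquivalence = record { isEquivalence = isEquivalence ; _≟_ = _≟_ } }

  open Counting decSetoid public
  open Size elements complete public

  infix 4 _∈_
  _∈_ : Carrier → Subgroup G → Set
  x ∈ K = T (Subset.χ (Subgroup.set K) x)

  InverseClosed : (Carrier → Bool) → Set c
  InverseClosed p = ∀ {x} → T (p x) → T (p (x ⁻¹))

  middle-solve : ∀ {a z b y} → y ≈ a ∙ z ∙ b → z ≈ a ⁻¹ ∙ y ∙ b ⁻¹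
  middle-solve {a} {z} {b} {y} y≈azb = sym (begin
    a ⁻¹ ∙ y ∙ b ⁻¹              ≈⟨ ∙-congʳ (∙-congˡ (trans y≈azb (assoc a z b))) ⟩
    a ⁻¹ ∙ (a ∙ (z ∙ b)) ∙ b ⁻¹  ≈⟨ ∙-congʳ (\\-leftDividesʳ a (z ∙ b)) ⟩
    z ∙ b ∙ b ⁻¹                 ≈⟨ //-rightDividesʳ b z ⟩
    z                            ∎)

  ∙-∙-shuffle : ∀ a h x k b → a ∙ (h ∙ x ∙ k) ∙ b ≈ a ∙ h ∙ x ∙ (k ∙ b)
  ∙-∙-shuffle a h x k b = begin
    a ∙ (h ∙ x ∙ k) ∙ b    ≈⟨ ∙-congʳ (sym (assoc a (h ∙ x) k)) ⟩
    a ∙ (h ∙ x) ∙ k ∙ b    ≈⟨ assoc _ k b ⟩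
    a ∙ (h ∙ x) ∙ (k ∙ b)  ≈⟨ ∙-congʳ (sym (assoc a h x)) ⟩
    a ∙ h ∙ x ∙ (k ∙ b)    ∎

  ⁻¹-anti-homo-∙∙ : ∀ a x b → (a ∙ x ∙ b) ⁻¹ ≈ b ⁻¹ ∙ x ⁻¹ ∙ a ⁻¹
  ⁻¹-anti-homo-∙∙ a x b = begin
    (a ∙ x ∙ b) ⁻¹          ≈⟨ ⁻¹-anti-homo-∙ (a ∙ x) b ⟩
    b ⁻¹ ∙ (a ∙ x) ⁻¹       ≈⟨ ∙-congˡ (⁻¹-anti-homo-∙ a x) ⟩
    b ⁻¹ ∙ (x ⁻¹ ∙ a ⁻¹)    ≈⟨ sym (assoc _ _ _) ⟩
    b ⁻¹ ∙ x ⁻¹ ∙ a ⁻¹      ∎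

  conjugate-square : ∀ b y → (b ⁻¹ ∙ y ∙ b) ∙ (b ⁻¹ ∙ y ∙ b) ≈ b ⁻¹ ∙ (y ∙ y) ∙ b
  conjugate-square b y = begin
    (b ⁻¹ ∙ y ∙ b) ∙ (b ⁻¹ ∙ y ∙ b)    ≈⟨ assoc (b ⁻¹ ∙ y) b _ ⟩
    b ⁻¹ ∙ y ∙ (b ∙ (b ⁻¹ ∙ y ∙ b))    ≈⟨ ∙-congˡ (sym (assoc b (b ⁻¹ ∙ y) b)) ⟩
    b ⁻¹ ∙ y ∙ (b ∙ (b ⁻¹ ∙ y) ∙ b)    ≈⟨ ∙-congˡ (∙-congʳ (\\-leftDividesˡ b y)) ⟩
    b ⁻¹ ∙ y ∙ (y ∙ b)                 ≈⟨ sym (assoc _ y b) ⟩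
    b ⁻¹ ∙ y ∙ y ∙ b                   ≈⟨ ∙-congʳ (assoc _ y y) ⟩
    b ⁻¹ ∙ (y ∙ y) ∙ b                 ∎

  [a⁻¹b]⁻¹[a⁻¹c]≈b⁻¹c : ∀ a b c → (a ⁻¹ ∙ b) ⁻¹ ∙ (a ⁻¹ ∙ c) ≈ b ⁻¹ ∙ c
  [a⁻¹b]⁻¹[a⁻¹c]≈b⁻¹c a b c = begin
    (a ⁻¹ ∙ b) ⁻¹ ∙ (a ⁻¹ ∙ c)    ≈⟨ ∙-congʳ (trans (⁻¹-anti-homo-∙ (a ⁻¹) b) (∙-congˡ (⁻¹-involutive a))) ⟩
    b ⁻¹ ∙ a ∙ (a ⁻¹ ∙ c)         ≈⟨ assoc (b ⁻¹) a _ ⟩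
    b ⁻¹ ∙ (a ∙ (a ⁻¹ ∙ c))       ≈⟨ ∙-congˡ (\\-leftDividesˡ a c) ⟩
    b ⁻¹ ∙ c                      ∎

  sameLeftCoset : ∀ {y a b a₁ a₂} → y ≈ a ∙ a₁ → y ≈ b ∙ a₂ → a ⁻¹ ∙ b ≈ a₁ ∙ a₂ ⁻¹
  sameLeftCoset {y} {a} {b} {a₁} {a₂} y≈aa₁ y≈ba₂ = begin
    a ⁻¹ ∙ b                 ≈⟨ ∙-congˡ (sym (//-rightDividesʳ a₂ b)) ⟩
    a ⁻¹ ∙ (b ∙ a₂ ∙ a₂ ⁻¹)  ≈⟨ ∙-congˡ (∙-congʳ (trans (sym y≈ba₂) y≈aa₁)) ⟩
    a ⁻¹ ∙ (a ∙ a₁ ∙ a₂ ⁻¹)  ≈⟨ ∙-congˡ (assoc a a₁ _) ⟩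
    a ⁻¹ ∙ (a ∙ (a₁ ∙ a₂ ⁻¹)) ≈⟨ \\-leftDividesʳ a _ ⟩
    a₁ ∙ a₂ ⁻¹               ∎

  [xh₁][xh₁]≈h₂⁻¹h₁ : ∀ {x h₁ h₂} → x ⁻¹ ≈ h₁ ∙ x ∙ h₂ → (x ∙ h₁) ∙ (x ∙ h₁) ≈ h₂ ⁻¹ ∙ h₁
  [xh₁][xh₁]≈h₂⁻¹h₁ {x} {h₁} {h₂} x⁻¹≈ = begin
    (x ∙ h₁) ∙ (x ∙ h₁)     ≈⟨ sym (assoc (x ∙ h₁) x h₁) ⟩
    x ∙ h₁ ∙ x ∙ h₁         ≈⟨ ∙-congʳ (assoc x h₁ x) ⟩
    x ∙ (h₁ ∙ x) ∙ h₁       ≈⟨ ∙-congʳ (∙-congˡ h₁x≈) ⟩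
    x ∙ (x ⁻¹ ∙ h₂ ⁻¹) ∙ h₁ ≈⟨ ∙-congʳ (\\-leftDividesˡ x (h₂ ⁻¹)) ⟩
    h₂ ⁻¹ ∙ h₁              ∎
    where
    h₁x≈ : h₁ ∙ x ≈ x ⁻¹ ∙ h₂ ⁻¹
    h₁x≈ = trans (sym (//-rightDividesʳ h₂ (h₁ ∙ x))) (∙-congʳ (sym x⁻¹≈))

  module Cosets (K : Subgroup G) where
    open Subgroup K public using (ε-mem; ∙-mem; ⁻¹-mem)

    χ : Carrier → Bool
    χ = Subset.χ (Subgroup.set K)

    χ-cong : χ Preserves _≈_ ⟶ _≡_
    χ-cong = Subset.respects (Subgroup.set K)

    ∈-resp-≈ : ∀ {x y} → x ≈ y → x ∈ K → y ∈ K
    ∈-resp-≈ x≈y = ≡.subst T (χ-cong x≈y)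

    size-χ-positive : 1 ≤ size χ
    size-χ-positive = size-positive χ-cong ε-mem

    LeftInvariant RightInvariant : (Carrier → Bool) → Set c
    LeftInvariant p  = ∀ {k y} → k ∈ K → T (p y) → T (p (k ∙ y))
    RightInvariant p = ∀ {y k} → T (p y) → k ∈ K → T (p (y ∙ k))

    ∖-leftInvariant : ∀ {p q} → q Preserves _≈_ ⟶ _≡_ →
                      LeftInvariant p → LeftInvariant q → LeftInvariant (p ∖ q)
    ∖-leftInvariant {p} {q} q-cong p-inv q-inv {k} {y} k∈K y∈p∖q =
      ∖⁺ p q (p-inv k∈K py) λ qky →
        ¬qy (≡.subst T (q-cong (\\-leftDividesʳ k y)) (q-inv (⁻¹-mem k∈K) qky))
      where
      py  = proj₁ (∖⁻ p q y∈p∖q)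
      ¬qy = proj₂ (∖⁻ p q y∈p∖q)

    ∖-rightInvariant : ∀ {p q} → q Preserves _≈_ ⟶ _≡_ →
                       RightInvariant p → RightInvariant q → RightInvariant (p ∖ q)
    ∖-rightInvariant {p} {q} q-cong p-inv q-inv {y} {k} y∈p∖q k∈K =
      ∖⁺ p q (p-inv py k∈K) λ qyk →
        ¬qy (≡.subst T (q-cong (//-rightDividesʳ k y)) (q-inv qyk (⁻¹-mem k∈K)))
      where
      py  = proj₁ (∖⁻ p q y∈p∖q)
      ¬qy = proj₂ (∖⁻ p q y∈p∖q)

    leftCoset : Carrier → Carrier → Bool
    leftCoset x y = χ (x ⁻¹ ∙ y)

    leftCoset-cong : ∀ x → leftCoset x Preserves _≈_ ⟶ _≡_
    leftCoset-cong x = χ-cong ∘ ∙-congˡ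

    leftCoset-rightInvariant : ∀ x → RightInvariant (leftCoset x)
    leftCoset-rightInvariant x {y} {k} x⁻¹y∈K k∈K =
      ∈-resp-≈ (assoc (x ⁻¹) y k) (∙-mem x⁻¹y∈K k∈K)

    leftCoset⊆ : ∀ {p x} → p Preserves _≈_ ⟶ _≡_ → RightInvariant p → T (p x) → leftCoset x ⊆ p
    leftCoset⊆ {x = x} p-cong p-inv px x⁻¹y∈K =
      ≡.subst T (p-cong (\\-leftDividesˡ x _)) (p-inv px x⁻¹y∈K)

    size-leftCoset : ∀ x → size (leftCoset x) ≡ size χ
    size-leftCoset x = size-∘-bijection χ-cong (x ⁻¹ ∙_) (x ∙_) ∙-congˡ ∙-congˡ
      (\\-leftDividesʳ x) (\\-leftDividesˡ x)

    record LeftCosetDecomposition (p : Carrier → Bool) : Set c where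
      field
        reps       : List Carrier
        reps⊆      : All (T ∘ p) reps
        reps-apart : AllPairs (λ a b → ¬ a ⁻¹ ∙ b ∈ K) reps
        reps-cover : ∀ {y} → T (p y) → Any (λ a → a ⁻¹ ∙ y ∈ K) reps
        size≡      : size p ≡ length reps * size χ

    leftCosetDecomposition : ∀ {p} → p Preserves _≈_ ⟶ _≡_ → RightInvariant p →
                             LeftCosetDecomposition p
    leftCosetDecomposition {p} p-cong p-inv = decompose (size p) p-cong p-inv ℕ.≤-refl
      where
      decompose : ∀ n {p} → p Preserves _≈_ ⟶ _≡_ → RightInvariant p → size p ≤ n →
                  LeftCosetDecomposition p
      decompose n {p} p-cong p-inv bound with empty⊎witness p p-cong
      ... | inj₁ none = record
        { reps = [] ; reps⊆ = [] ; reps-apart = []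
        ; reps-cover = λ {y} py → ⊥-elim (none y py) ; size≡ = size-empty none }
      decompose zero {p} p-cong p-inv bound | inj₂ (x , px)
        with ℕ.≤-trans (size-positive p-cong px) bound
      ... | ()
      decompose (suc n) {p} p-cong p-inv bound | inj₂ (x , px) = record
        { reps       = x ∷ reps
        ; reps⊆      = px ∷ All.map (λ qy → proj₁ (∖⁻ p (leftCoset x) qy)) reps⊆
        ; reps-apart = All.map (λ qy → proj₂ (∖⁻ p (leftCoset x) qy)) reps⊆ ∷ reps-apart
        ; reps-cover = cover
        ; size≡      = ≡.trans split (≡.cong (size χ +_) size≡) }
        where
        split : size p ≡ size χ + size (p ∖ leftCoset x)
        split = ≡.trans (size-⊆-split (leftCoset⊆ p-cong p-inv px))
                        (≡.cong (_+ size (p ∖ leftCoset x)) (size-leftCoset x))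
        open LeftCosetDecomposition
          (decompose n {p ∖ leftCoset x} (∖-cong p-cong (leftCoset-cong x))
            (∖-rightInvariant {p} {leftCoset x} (leftCoset-cong x) p-inv (leftCoset-rightInvariant x))
            (≤-peel size-χ-positive (≡.subst (_≤ suc n) split bound)))
        cover : ∀ {y} → T (p y) → Any (λ a → a ⁻¹ ∙ y ∈ K) (x ∷ reps)
        cover {y} py with T? (leftCoset x y)
        ... | yes x⁻¹y∈K  = here x⁻¹y∈K
        ... | no  x⁻¹y∉K = there (reps-cover (∖⁺ p (leftCoset x) py x⁻¹y∉K))

    DoubleCoset : Carrier → Carrier → Set (c ⊔ ℓ)
    DoubleCoset x y = ∃ λ h₁ → ∃ λ h₂ → h₁ ∈ K × h₂ ∈ K × y ≈ h₁ ∙ x ∙ h₂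

    doubleCoset-resp : ∀ {x y y′} → y ≈ y′ → DoubleCoset x y → DoubleCoset x y′
    doubleCoset-resp y≈y′ (h₁ , h₂ , h₁∈K , h₂∈K , y≈) = h₁ , h₂ , h₁∈K , h₂∈K , trans (sym y≈y′) y≈

    doubleCoset-refl : ∀ {x} → DoubleCoset x x
    doubleCoset-refl {x} = ε , ε , ε-mem , ε-mem , sym (trans (identityʳ (ε ∙ x)) (identityˡ x))

    doubleCoset-reflexive : ∀ {x y} → x ≈ y → DoubleCoset x y
    doubleCoset-reflexive x≈y = doubleCoset-resp x≈y doubleCoset-refl

    doubleCoset-∙ : ∀ {x y a b} → a ∈ K → b ∈ K → DoubleCoset x y → DoubleCoset x (a ∙ y ∙ b)
    doubleCoset-∙ {x} {a = a} {b} a∈K b∈K (h₁ , h₂ , h₁∈K , h₂∈K , y≈) =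
      a ∙ h₁ , h₂ ∙ b , ∙-mem a∈K h₁∈K , ∙-mem h₂∈K b∈K ,
      trans (∙-congʳ (∙-congˡ y≈)) (∙-∙-shuffle a h₁ x h₂ b)

    doubleCoset-∙ˡ : ∀ {x y k} → k ∈ K → DoubleCoset x y → DoubleCoset x (k ∙ y)
    doubleCoset-∙ˡ {k = k} k∈K = doubleCoset-resp (identityʳ _) ∘ doubleCoset-∙ k∈K ε-mem

    doubleCoset-∙ʳ : ∀ {x y k} → k ∈ K → DoubleCoset x y → DoubleCoset x (y ∙ k)
    doubleCoset-∙ʳ k∈K = doubleCoset-resp (∙-congʳ (identityˡ _)) ∘ doubleCoset-∙ ε-mem k∈K

    doubleCoset-sym : ∀ {x y} → DoubleCoset x y → DoubleCoset y x
    doubleCoset-sym (h₁ , h₂ , h₁∈K , h₂∈K , y≈) =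
      h₁ ⁻¹ , h₂ ⁻¹ , ⁻¹-mem h₁∈K , ⁻¹-mem h₂∈K , middle-solve y≈

    doubleCoset-trans : ∀ {x y z} → DoubleCoset x y → DoubleCoset y z → DoubleCoset x z
    doubleCoset-trans x~y (h₁ , h₂ , h₁∈K , h₂∈K , z≈) =
      doubleCoset-resp (sym z≈) (doubleCoset-∙ h₁∈K h₂∈K x~y)

    doubleCoset-⁻¹ : ∀ {x y} → DoubleCoset x y → DoubleCoset (x ⁻¹) (y ⁻¹)
    doubleCoset-⁻¹ (h₁ , h₂ , h₁∈K , h₂∈K , y≈) =
      h₂ ⁻¹ , h₁ ⁻¹ , ⁻¹-mem h₂∈K , ⁻¹-mem h₁∈K , trans (⁻¹-cong y≈) (⁻¹-anti-homo-∙∙ _ _ _)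

    doubleCoset-⁻¹ˡ : ∀ {x y} → DoubleCoset (x ⁻¹) y → DoubleCoset x (y ⁻¹)
    doubleCoset-⁻¹ˡ x⁻¹~y =
      doubleCoset-trans (doubleCoset-reflexive (sym (⁻¹-involutive _))) (doubleCoset-⁻¹ x⁻¹~y)

    doubleCoset-⁻¹ʳ : ∀ {x y} → DoubleCoset x (y ⁻¹) → DoubleCoset (x ⁻¹) y
    doubleCoset-⁻¹ʳ x~y⁻¹ = doubleCoset-resp (⁻¹-involutive _) (doubleCoset-⁻¹ x~y⁻¹)

    doubleCoset-∈ : ∀ {x y} → DoubleCoset x y → y ∈ K → x ∈ K
    doubleCoset-∈ x~y y∈K with doubleCoset-sym x~y
    ... | h₁ , h₂ , h₁∈K , h₂∈K , x≈ = ∈-resp-≈ (sym x≈) (∙-mem (∙-mem h₁∈K y∈K) h₂∈K)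

    doubleCoset : Carrier → Carrier → Bool
    doubleCoset x y = any (χ ∩ λ h → χ (x ⁻¹ ∙ (h ∙ y))) enumeration

    doubleCoset-sound : ∀ {x y} → T (doubleCoset x y) → DoubleCoset x y
    doubleCoset-sound {x} {y} t with Any.satisfied (any⁻ _ enumeration t)
    ... | h , h∈K∩ =
      h ⁻¹ , x ⁻¹ ∙ (h ∙ y) , ⁻¹-mem (proj₁ h∈K,x⁻¹hy∈K) , proj₂ h∈K,x⁻¹hy∈K , sym (begin
        h ⁻¹ ∙ x ∙ (x ⁻¹ ∙ (h ∙ y))    ≈⟨ assoc (h ⁻¹) x _ ⟩
        h ⁻¹ ∙ (x ∙ (x ⁻¹ ∙ (h ∙ y)))  ≈⟨ ∙-congˡ (\\-leftDividesˡ x (h ∙ y)) ⟩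
        h ⁻¹ ∙ (h ∙ y)                 ≈⟨ \\-leftDividesʳ h y ⟩
        y                              ∎)
      where
      h∈K,x⁻¹hy∈K = ∩⁻ χ (λ h → χ (x ⁻¹ ∙ (h ∙ y))) h∈K∩

    doubleCoset-complete : ∀ {x y} → DoubleCoset x y → T (doubleCoset x y)
    doubleCoset-complete {x} {y} (h₁ , h₂ , h₁∈K , h₂∈K , y≈) =
      any⁺ _ (Any.map witness (enumeration-complete (h₁ ⁻¹)))
      where
      witness : ∀ {h} → h₁ ⁻¹ ≈ h → T ((χ ∩ λ h → χ (x ⁻¹ ∙ (h ∙ y))) h)
      witness {h} h₁⁻¹≈h = ∩⁺ χ (λ h → χ (x ⁻¹ ∙ (h ∙ y)))
        (∈-resp-≈ h₁⁻¹≈h (⁻¹-mem h₁∈K)) (∈-resp-≈ (sym x⁻¹hy≈h₂) h₂∈K)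
        where
        x⁻¹hy≈h₂ : x ⁻¹ ∙ (h ∙ y) ≈ h₂
        x⁻¹hy≈h₂ = begin
          x ⁻¹ ∙ (h ∙ y)                 ≈⟨ ∙-congˡ (∙-cong (sym h₁⁻¹≈h) (trans y≈ (assoc h₁ x h₂))) ⟩
          x ⁻¹ ∙ (h₁ ⁻¹ ∙ (h₁ ∙ (x ∙ h₂))) ≈⟨ ∙-congˡ (\\-leftDividesʳ h₁ (x ∙ h₂)) ⟩
          x ⁻¹ ∙ (x ∙ h₂)                 ≈⟨ \\-leftDividesʳ x h₂ ⟩
          h₂                              ∎

    doubleCoset-cong : ∀ x → doubleCoset x Preserves _≈_ ⟶ _≡_
    doubleCoset-cong x y≈y′ = T-extensional
      (doubleCoset-complete ∘ doubleCoset-resp y≈y′ ∘ doubleCoset-sound)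
      (doubleCoset-complete ∘ doubleCoset-resp (sym y≈y′) ∘ doubleCoset-sound)

    doubleCoset-rightInvariant : ∀ x → RightInvariant (doubleCoset x)
    doubleCoset-rightInvariant x t k∈K =
      doubleCoset-complete (doubleCoset-∙ʳ k∈K (doubleCoset-sound t))

    doubleCoset-leftInvariant : ∀ x → LeftInvariant (doubleCoset x)
    doubleCoset-leftInvariant x k∈K t =
      doubleCoset-complete (doubleCoset-∙ˡ k∈K (doubleCoset-sound t))

    doubleCoset⊆ : ∀ {p x} → p Preserves _≈_ ⟶ _≡_ → LeftInvariant p → RightInvariant p →
                   T (p x) → doubleCoset x ⊆ p
    doubleCoset⊆ p-cong p-invˡ p-invʳ px t with doubleCoset-sound t
    ... | h₁ , h₂ , h₁∈K , h₂∈K , y≈ = ≡.subst T (p-cong (sym y≈)) (p-invʳ (p-invˡ h₁∈K px) h₂∈K)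

    size∣size-doubleCoset : ∀ x → size χ ∣ size (doubleCoset x)
    size∣size-doubleCoset x = divides (length reps) size≡
      where open LeftCosetDecomposition
              (leftCosetDecomposition {doubleCoset x} (doubleCoset-cong x) (doubleCoset-rightInvariant x))

    size-doubleCoset-⁻¹ : ∀ x → size (doubleCoset (x ⁻¹)) ≡ size (doubleCoset x)
    size-doubleCoset-⁻¹ x = ≡.trans
      (size-cong {q = doubleCoset x ∘ _⁻¹}
        (doubleCoset-complete ∘ doubleCoset-⁻¹ˡ ∘ doubleCoset-sound)
        (doubleCoset-complete ∘ doubleCoset-⁻¹ʳ ∘ doubleCoset-sound))
      (size-∘-bijection (doubleCoset-cong x) _⁻¹ _⁻¹ ⁻¹-cong ⁻¹-cong ⁻¹-involutive ⁻¹-involutive)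

    SelfInverse : Carrier → Set (c ⊔ ℓ)
    SelfInverse x = DoubleCoset x (x ⁻¹)

    module RemoveDoubleCosetPair {p x} (p-cong : p Preserves _≈_ ⟶ _≡_)
      (p-invˡ : LeftInvariant p) (p-invʳ : RightInvariant p) (p-inv : InverseClosed p)
      (px : T (p x)) (¬self : ¬ SelfInverse x) where

      rest : Carrier → Bool
      rest = p ∖ doubleCoset x ∖ doubleCoset (x ⁻¹)

      rest⊆p : rest ⊆ p
      rest⊆p t = proj₁ (∖⁻ p (doubleCoset x) (proj₁ (∖⁻ (p ∖ doubleCoset x) (doubleCoset (x ⁻¹)) t)))

      rest-cong : rest Preserves _≈_ ⟶ _≡_
      rest-cong = ∖-cong (∖-cong p-cong (doubleCoset-cong x)) (doubleCoset-cong (x ⁻¹))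

      rest-leftInvariant : LeftInvariant rest
      rest-leftInvariant = ∖-leftInvariant {p ∖ doubleCoset x} (doubleCoset-cong (x ⁻¹))
        (∖-leftInvariant {p} (doubleCoset-cong x) p-invˡ (doubleCoset-leftInvariant x))
        (doubleCoset-leftInvariant (x ⁻¹))

      rest-rightInvariant : RightInvariant rest
      rest-rightInvariant = ∖-rightInvariant {p ∖ doubleCoset x} (doubleCoset-cong (x ⁻¹))
        (∖-rightInvariant {p} (doubleCoset-cong x) p-invʳ (doubleCoset-rightInvariant x))
        (doubleCoset-rightInvariant (x ⁻¹))

      rest-inverseClosed : InverseClosed rest
      rest-inverseClosed {y} t =
        ∖⁺ (p ∖ doubleCoset x) (doubleCoset (x ⁻¹))
          (∖⁺ p (doubleCoset x) (p-inv py)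
            (y∉Kx⁻¹K ∘ doubleCoset-complete ∘ doubleCoset-⁻¹ʳ ∘ doubleCoset-sound))
          (y∉KxK ∘ doubleCoset-complete ∘ doubleCoset-resp (⁻¹-involutive y) ∘ doubleCoset-⁻¹ˡ ∘
           doubleCoset-sound)
        where
        y∈p∖KxK  = proj₁ (∖⁻ (p ∖ doubleCoset x) (doubleCoset (x ⁻¹)) t)
        y∉Kx⁻¹K = proj₂ (∖⁻ (p ∖ doubleCoset x) (doubleCoset (x ⁻¹)) t)
        py       = proj₁ (∖⁻ p (doubleCoset x) y∈p∖KxK)
        y∉KxK    = proj₂ (∖⁻ p (doubleCoset x) y∈p∖KxK)

      size-split : size p ≡ 2 * size (doubleCoset x) + size rest
      size-split = ≡.trans (size-⊆-split KxK⊆p)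
        (≡.trans (≡.cong (size (doubleCoset x) +_)
                   (≡.trans (size-⊆-split Kx⁻¹K⊆p∖KxK) (≡.cong (_+ size rest) (size-doubleCoset-⁻¹ x))))
                 (m+[m+n]≡2m+n (size (doubleCoset x)) (size rest)))
        where
        KxK⊆p : doubleCoset x ⊆ p
        KxK⊆p = doubleCoset⊆ p-cong p-invˡ p-invʳ px
        Kx⁻¹K⊆p∖KxK : doubleCoset (x ⁻¹) ⊆ p ∖ doubleCoset x
        Kx⁻¹K⊆p∖KxK t = ∖⁺ p (doubleCoset x)
          (doubleCoset⊆ p-cong p-invˡ p-invʳ (p-inv px) t)
          (λ t′ → ¬self (doubleCoset-trans (doubleCoset-sound t′) (doubleCoset-sym (doubleCoset-sound t))))
        m+[m+n]≡2m+n : ∀ m n → m + (m + n) ≡ 2 * m + n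
        m+[m+n]≡2m+n = solve-∀

      rest-smaller : ∀ {n} → size p ≤ suc n → size rest ≤ n
      rest-smaller {n} bound = ≤-peel 1≤2|KxK| (≡.subst (_≤ suc n) size-split bound)
        where
        1≤2|KxK| : 1 ≤ 2 * size (doubleCoset x)
        1≤2|KxK| = ℕ.≤-trans (size-positive (doubleCoset-cong x) (doubleCoset-complete doubleCoset-refl))
                             (ℕ.m≤m+n _ _)

      2|K|∣size-rest⇒2|K|∣size : 2 * size χ ∣ size rest → 2 * size χ ∣ size p
      2|K|∣size-rest⇒2|K|∣size 2|K|∣size-rest = ≡.subst (2 * size χ ∣_) (≡.sym size-split)
        (∣m∣n⇒∣m+n (*-monoʳ-∣ 2 (size∣size-doubleCoset x)) 2|K|∣size-rest)

    selfInverse⊎evenCosetCount : ∀ {p} → p Preserves _≈_ ⟶ _≡_ → LeftInvariant p →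
      RightInvariant p → InverseClosed p → (∃ λ x → T (p x) × SelfInverse x) ⊎ 2 * size χ ∣ size p
    selfInverse⊎evenCosetCount {p} p-cong p-invˡ p-invʳ p-inv =
      go (size p) p-cong p-invˡ p-invʳ p-inv ℕ.≤-refl
      where
      go : ∀ n {p} → p Preserves _≈_ ⟶ _≡_ → LeftInvariant p → RightInvariant p → InverseClosed p →
           size p ≤ n → (∃ λ x → T (p x) × SelfInverse x) ⊎ 2 * size χ ∣ size p
      go n {p} p-cong p-invˡ p-invʳ p-inv bound with empty⊎witness p p-cong
      ... | inj₁ none = inj₂ (≡.subst (2 * size χ ∣_) (≡.sym (size-empty none)) (_ ∣0))
      go zero p-cong p-invˡ p-invʳ p-inv bound | inj₂ (x , px)
        with ℕ.≤-trans (size-positive p-cong px) bound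
      ... | ()
      go (suc n) {p} p-cong p-invˡ p-invʳ p-inv bound | inj₂ (x , px) with T? (doubleCoset x (x ⁻¹))
      ... | yes self = inj₁ (x , px , doubleCoset-sound self)
      ... | no ¬self = Sum.map (λ (y , y∈rest , y-self) → y , rest⊆p y∈rest , y-self)
                         2|K|∣size-rest⇒2|K|∣size
                         (go n rest-cong rest-leftInvariant rest-rightInvariant rest-inverseClosed
                             (rest-smaller bound))
        where open RemoveDoubleCosetPair p-cong p-invˡ p-invʳ p-inv px (¬self ∘ doubleCoset-complete)

  module PerfectCode (H A : Subgroup G) (H≤A : _≤G_ G H A) (U : Subset G)
                     (U-connection : ConnectionSet G H U) (U-code : IsPerfectCodeIn G H A U) where
    module H = Cosets H
    module A = Cosets A
    open ConnectionSet U-connection using (doubleCosets; symmetric)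

    infix 4 _∈U
    _∈U : Carrier → Set
    x ∈U = T (Subset.χ U x)

    ∈U-resp-≈ : ∀ {x y} → x ≈ y → x ∈U → y ∈U
    ∈U-resp-≈ x≈y = ≡.subst T (Subset.respects U x≈y)

    H⊆A : ∀ {x} → x ∈ H → x ∈ A
    H⊆A = H≤A _

    ∈A⇒inCode : ∀ {x} → x ∈ A → inCode G H A x
    ∈A⇒inCode {x} x∈A = x , x∈A , H.∈-resp-≈ (sym (inverseˡ x)) H.ε-mem

    inCode⇒∈A : ∀ {x} → inCode G H A x → x ∈ A
    inCode⇒∈A {x} (a , a∈A , x⁻¹a∈H) =
      A.∈-resp-≈ a[x⁻¹a]⁻¹≈x (A.∙-mem a∈A (A.⁻¹-mem (H⊆A x⁻¹a∈H)))
      where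
      a[x⁻¹a]⁻¹≈x : a ∙ (x ⁻¹ ∙ a) ⁻¹ ≈ x
      a[x⁻¹a]⁻¹≈x = begin
        a ∙ (x ⁻¹ ∙ a) ⁻¹   ≈⟨ ∙-congˡ (trans (⁻¹-anti-homo-∙ (x ⁻¹) a) (∙-congˡ (⁻¹-involutive x))) ⟩
        a ∙ (a ⁻¹ ∙ x)      ≈⟨ \\-leftDividesˡ a x ⟩
        x                   ∎

    U∩A≡∅ : ∀ {x} → x ∈ A → ¬ x ∈U
    U∩A≡∅ {x} x∈A x∈U = proj₁ U-code ε x (∈A⇒inCode A.ε-mem) (∈A⇒inCode x∈A)
      (∈U-resp-≈ (sym (trans (∙-congʳ ε⁻¹≈ε) (identityˡ x))) x∈U)

    codeNeighbours-sameCoset : ∀ {x z z′} → ¬ inCode G H A x →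
      inCode G H A z → adjacent G U x z → inCode G H A z′ → adjacent G U x z′ → z ⁻¹ ∙ z′ ∈ H
    codeNeighbours-sameCoset {x} {z} {z′} x∉C z∈C x~z z′∈C x~z′ =
      let y , _ , _ , unique = proj₂ U-code x x∉C
      in  H.∈-resp-≈ ([a⁻¹b]⁻¹[a⁻¹c]≈b⁻¹c y z z′)
            (H.∙-mem (H.⁻¹-mem (unique z z∈C x~z)) (unique z′ z′∈C x~z′))

    ∈U-quotient-∈A⇒∈H : ∀ {u v} → u ∈U → v ∈U → u ⁻¹ ∙ v ∈ A → u ⁻¹ ∙ v ∈ H
    ∈U-quotient-∈A⇒∈H {u} {v} u∈U v∈U u⁻¹v∈A =
      H.∈-resp-≈ (trans (∙-congʳ ε⁻¹≈ε) (identityˡ _))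
        (codeNeighbours-sameCoset u⁻¹∉C (∈A⇒inCode A.ε-mem)
          (∈U-resp-≈ (sym (trans (identityʳ _) (⁻¹-involutive u))) u∈U)
          (∈A⇒inCode u⁻¹v∈A)
          (∈U-resp-≈ (sym (trans (∙-congʳ (⁻¹-involutive u)) (\\-leftDividesˡ u v))) v∈U))
      where
      u⁻¹∉C : ¬ inCode G H A (u ⁻¹)
      u⁻¹∉C u⁻¹∈C = U∩A≡∅ (A.∈-resp-≈ (⁻¹-involutive u) (A.⁻¹-mem (inCode⇒∈A u⁻¹∈C))) u∈U

    ∉A⇒∙∈U : ∀ {y} → ¬ y ∈ A → ∃ λ z → z ∈ A × y ∙ z ∈U
    ∉A⇒∙∈U {y} y∉A =
      let z , z∈C , y⁻¹⁻¹z∈U , _ = proj₂ U-code (y ⁻¹) y⁻¹∉C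
      in  z , inCode⇒∈A z∈C , ∈U-resp-≈ (∙-congʳ (⁻¹-involutive y)) y⁻¹⁻¹z∈U
      where
      y⁻¹∉C : ¬ inCode G H A (y ⁻¹)
      y⁻¹∉C y⁻¹∈C = y∉A (A.∈-resp-≈ (⁻¹-involutive y) (A.⁻¹-mem (inCode⇒∈A y⁻¹∈C)))

    module _ (g : Carrier) where

      DoubleSet : Carrier → Set (c ⊔ ℓ)
      DoubleSet y = A.DoubleCoset g y ⊎ A.DoubleCoset (g ⁻¹) y

      inDoubleSet⇒DoubleSet : ∀ {y} → inDoubleSet G A g y → DoubleSet y
      inDoubleSet⇒DoubleSet (a₁ , a₂ , a₁∈A , a₂∈A , inj₁ y≈) = inj₁ (a₁ , a₂ , a₁∈A , a₂∈A , y≈)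
      inDoubleSet⇒DoubleSet (a₁ , a₂ , a₁∈A , a₂∈A , inj₂ y≈) = inj₂ (a₁ , a₂ , a₁∈A , a₂∈A , y≈)

      DoubleSet⇒inDoubleSet : ∀ {y} → DoubleSet y → inDoubleSet G A g y
      DoubleSet⇒inDoubleSet (inj₁ (a₁ , a₂ , a₁∈A , a₂∈A , y≈)) = a₁ , a₂ , a₁∈A , a₂∈A , inj₁ y≈
      DoubleSet⇒inDoubleSet (inj₂ (a₁ , a₂ , a₁∈A , a₂∈A , y≈)) = a₁ , a₂ , a₁∈A , a₂∈A , inj₂ y≈

      doubleSet-resp : ∀ {y y′} → y ≈ y′ → DoubleSet y → DoubleSet y′
      doubleSet-resp y≈y′ = Sum.map (A.doubleCoset-resp y≈y′) (A.doubleCoset-resp y≈y′)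

      doubleSet-∙ˡ : ∀ {y k} → k ∈ A → DoubleSet y → DoubleSet (k ∙ y)
      doubleSet-∙ˡ k∈A = Sum.map (A.doubleCoset-∙ˡ k∈A) (A.doubleCoset-∙ˡ k∈A)

      doubleSet-∙ʳ : ∀ {y k} → k ∈ A → DoubleSet y → DoubleSet (y ∙ k)
      doubleSet-∙ʳ k∈A = Sum.map (A.doubleCoset-∙ʳ k∈A) (A.doubleCoset-∙ʳ k∈A)

      doubleSet-⁻¹ : ∀ {y} → DoubleSet y → DoubleSet (y ⁻¹)
      doubleSet-⁻¹ (inj₁ g~y)   = inj₂ (A.doubleCoset-⁻¹ g~y)
      doubleSet-⁻¹ (inj₂ g⁻¹~y) = inj₁ (A.doubleCoset-⁻¹ˡ g⁻¹~y)

      doubleSet-∉A : ¬ g ∈ A → ∀ {y} → DoubleSet y → ¬ y ∈ A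
      doubleSet-∉A g∉A (inj₁ g~y)   y∈A = g∉A (A.doubleCoset-∈ g~y y∈A)
      doubleSet-∉A g∉A (inj₂ g⁻¹~y) y∈A =
        g∉A (A.∈-resp-≈ (⁻¹-involutive g) (A.⁻¹-mem (A.doubleCoset-∈ g⁻¹~y y∈A)))

      W : Carrier → Bool
      W y = Subset.χ U y ∧ (A.doubleCoset g y ∨ A.doubleCoset (g ⁻¹) y)

      W⁺ : ∀ {y} → y ∈U → DoubleSet y → T (W y)
      W⁺ {y} y∈U y∈D = ∩⁺ (Subset.χ U) (λ y → A.doubleCoset g y ∨ A.doubleCoset (g ⁻¹) y) y∈U
        (Equivalence.from (T-∨ {A.doubleCoset g y})
          (Sum.map A.doubleCoset-complete A.doubleCoset-complete y∈D))

      W⁻ : ∀ {y} → T (W y) → y ∈U × DoubleSet y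
      W⁻ {y} y∈W =
        let y∈U , y∈D = ∩⁻ (Subset.χ U) (λ y → A.doubleCoset g y ∨ A.doubleCoset (g ⁻¹) y) y∈W
        in  y∈U , Sum.map A.doubleCoset-sound A.doubleCoset-sound (Equivalence.to (T-∨ {A.doubleCoset g y}) y∈D)

      W-cong : W Preserves _≈_ ⟶ _≡_
      W-cong y≈y′ = ≡.cong₂ _∧_ (Subset.respects U y≈y′)
        (≡.cong₂ _∨_ (A.doubleCoset-cong g y≈y′) (A.doubleCoset-cong (g ⁻¹) y≈y′))

      W-leftInvariant : H.LeftInvariant W
      W-leftInvariant {k} {y} k∈H y∈W = W⁺
        (∈U-resp-≈ (identityʳ (k ∙ y)) (doubleCosets k y ε k∈H (proj₁ (W⁻ y∈W)) H.ε-mem))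
        (doubleSet-∙ˡ (H⊆A k∈H) (proj₂ (W⁻ y∈W)))

      W-rightInvariant : H.RightInvariant W
      W-rightInvariant {y} {k} y∈W k∈H = W⁺
        (∈U-resp-≈ (∙-congʳ (identityˡ y)) (doubleCosets ε y k H.ε-mem (proj₁ (W⁻ y∈W)) k∈H))
        (doubleSet-∙ʳ (H⊆A k∈H) (proj₂ (W⁻ y∈W)))

      W-inverseClosed : InverseClosed W
      W-inverseClosed {y} y∈W = W⁺ (symmetric y (proj₁ (W⁻ y∈W))) (doubleSet-⁻¹ (proj₂ (W⁻ y∈W)))

      squareAlternative-∈A : g ∈ A → SquareAlternative G H A g
      squareAlternative-∈A g∈A =
        ε , (g ⁻¹ , A.⁻¹-mem g∈A , sym (inverseʳ g)) , ε , A.ε-mem , ε , H.ε-mem ,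
        trans (identityʳ ε) (sym (trans (identityʳ _) (inverseˡ ε)))

      squareAlternative-doubleCoset : ∀ {y} → A.DoubleCoset g y → y ∙ y ∈ H → SquareAlternative G H A g
      squareAlternative-doubleCoset {y} (a₁ , a₂ , a₁∈A , a₂∈A , y≈) yy∈H =
        a₁ ⁻¹ ∙ y ∙ a₁ , (a₂ ∙ a₁ , A.∙-mem a₂∈A a₁∈A , conjugate≈) ,
        a₁ , a₁∈A , y ∙ y , yy∈H , conjugate-square a₁ y
        where
        conjugate≈ : a₁ ⁻¹ ∙ y ∙ a₁ ≈ g ∙ (a₂ ∙ a₁)
        conjugate≈ = begin
          a₁ ⁻¹ ∙ y ∙ a₁              ≈⟨ ∙-congʳ (∙-congˡ (trans y≈ (assoc a₁ g a₂))) ⟩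
          a₁ ⁻¹ ∙ (a₁ ∙ (g ∙ a₂)) ∙ a₁ ≈⟨ ∙-congʳ (\\-leftDividesʳ a₁ (g ∙ a₂)) ⟩
          g ∙ a₂ ∙ a₁                 ≈⟨ assoc g a₂ a₁ ⟩
          g ∙ (a₂ ∙ a₁)               ∎

      squareAlternative-doubleSet : ∀ {y} → DoubleSet y → y ∙ y ∈ H → SquareAlternative G H A g
      squareAlternative-doubleSet (inj₁ g~y)       yy∈H = squareAlternative-doubleCoset g~y yy∈H
      squareAlternative-doubleSet {y} (inj₂ g⁻¹~y) yy∈H = squareAlternative-doubleCoset
        (A.doubleCoset-⁻¹ˡ g⁻¹~y) (H.∈-resp-≈ (⁻¹-anti-homo-∙ y y) (H.⁻¹-mem yy∈H))

      squareAlternative-selfInverse : ∀ {x} → T (W x) → H.SelfInverse x → SquareAlternative G H A g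
      squareAlternative-selfInverse {x} x∈W (h₁ , h₂ , h₁∈H , h₂∈H , x⁻¹≈) =
        squareAlternative-doubleSet (doubleSet-∙ʳ (H⊆A h₁∈H) (proj₂ (W⁻ x∈W)))
          (H.∈-resp-≈ (sym ([xh₁][xh₁]≈h₂⁻¹h₁ x⁻¹≈)) (H.∙-mem (H.⁻¹-mem h₂∈H) h₁∈H))

      module _ (g∉A : ¬ g ∈ A) where
        open H.LeftCosetDecomposition (H.leftCosetDecomposition W-cong W-rightInvariant)

        cosets-disjoint : AllPairs (λ gᵢ gⱼ → ∀ y → ¬ (inLeftCoset G A gᵢ y × inLeftCoset G A gⱼ y)) reps
        cosets-disjoint = AllPairs-mapWith disjoint reps⊆ reps-apart
          where
          disjoint : ∀ {a b} → T (W a) → T (W b) → ¬ a ⁻¹ ∙ b ∈ H →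
                     ∀ y → ¬ (inLeftCoset G A a y × inLeftCoset G A b y)
          disjoint a∈W b∈W a⁻¹b∉H y ((a₁ , a₁∈A , y≈aa₁) , (a₂ , a₂∈A , y≈ba₂)) =
            a⁻¹b∉H (∈U-quotient-∈A⇒∈H (proj₁ (W⁻ a∈W)) (proj₁ (W⁻ b∈W))
              (A.∈-resp-≈ (sym (sameLeftCoset y≈aa₁ y≈ba₂)) (A.∙-mem a₁∈A (A.⁻¹-mem a₂∈A))))

        cosets-cover : ∀ y → inDoubleSet G A g y ⇔ Any (λ gᵢ → inLeftCoset G A gᵢ y) reps
        cosets-cover y = mk⇔ covered fromCoset
          where
          toCoset : ∀ {z a} → z ∈ A → a ⁻¹ ∙ (y ∙ z) ∈ H → inLeftCoset G A a y
          toCoset {z} {a} z∈A a⁻¹yz∈H =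
            a ⁻¹ ∙ (y ∙ z) ∙ z ⁻¹ , A.∙-mem (H⊆A a⁻¹yz∈H) (A.⁻¹-mem z∈A) , sym (begin
              a ∙ (a ⁻¹ ∙ (y ∙ z) ∙ z ⁻¹)  ≈⟨ sym (assoc a _ _) ⟩
              a ∙ (a ⁻¹ ∙ (y ∙ z)) ∙ z ⁻¹  ≈⟨ ∙-congʳ (\\-leftDividesˡ a (y ∙ z)) ⟩
              y ∙ z ∙ z ⁻¹                 ≈⟨ //-rightDividesʳ z y ⟩
              y                            ∎)
          covered : inDoubleSet G A g y → Any (λ gᵢ → inLeftCoset G A gᵢ y) reps
          covered y∈D = viaU (∉A⇒∙∈U (doubleSet-∉A g∉A y∈D′))
            where
            y∈D′ = inDoubleSet⇒DoubleSet y∈D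
            viaU : (∃ λ z → z ∈ A × y ∙ z ∈U) → Any (λ gᵢ → inLeftCoset G A gᵢ y) reps
            viaU (z , z∈A , yz∈U) = Any.map (toCoset z∈A) (reps-cover (W⁺ yz∈U (doubleSet-∙ʳ z∈A y∈D′)))
          fromCoset : Any (λ gᵢ → inLeftCoset G A gᵢ y) reps → inDoubleSet G A g y
          fromCoset = fromRep ∘ lookupAny reps⊆
            where
            fromRep : ∀ {a} → T (W a) × inLeftCoset G A a y → inDoubleSet G A g y
            fromRep (a∈W , a′ , a′∈A , y≈aa′) =
              DoubleSet⇒inDoubleSet (doubleSet-resp (sym y≈aa′) (doubleSet-∙ʳ a′∈A (proj₂ (W⁻ a∈W))))

        evenCosetAlternative : 2 * size H.χ ∣ size W → EvenCosetAlternative G A g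
        evenCosetAlternative 2|H|∣size-W = reps , cosets-disjoint , cosets-cover ,
          *-cancelʳ-∣ (size H.χ) {{>-nonZero H.size-χ-positive}}
            (≡.subst (2 * size H.χ ∣_) size≡ 2|H|∣size-W)

      dichotomy : SquareAlternative G H A g ⊎ EvenCosetAlternative G A g
      dichotomy with T? (A.χ g)
      ... | yes g∈A = inj₁ (squareAlternative-∈A g∈A)
      ... | no g∉A with H.selfInverse⊎evenCosetCount W-cong W-leftInvariant W-rightInvariant W-inverseClosed
      ...   | inj₁ (x , x∈W , x-selfInverse) = inj₁ (squareAlternative-selfInverse x∈W x-selfInverse)
      ...   | inj₂ 2|H|∣size-W              = inj₂ (evenCosetAlternative g∉A 2|H|∣size-W)

theorem3p7 : {c ℓ : Level} (G : FiniteGroup c ℓ) (H A : Subgroup G) →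
    _≤G_ G H A → PerfectCodeOfPair G H A →
    (g : FiniteGroup.Carrier G) →
    SquareAlternative G H A g ⊎ EvenCosetAlternative G A g
theorem3p7 G H A H≤A (U , U-connection , U-code) =
  FiniteGroupTheory.PerfectCode.dichotomy G H A H≤A U U-connection U-code
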